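{- Let $G$ be a graph on ten vertices such that both $G$ and $\overline{G}$ are minimally t-imperfect. Suppose $G$ contains a $5$-hole $v_1v_2v_3v_4v_5$ and the other five vertices are $u_1,\dots,u_5$, where for each $i$ the neighbours of $u_i$ on the hole are $v_{i+2}$, $v_{i+3}$ and possibly $v_i$ (indices modulo $5$). Let $i\in\{1,\dots,5\}$. If neither $u_iu_{i-1}$ nor $u_iu_{i+1}$ is an edge of $G$, then $u_{i-1}u_{i+1}$ is not an edge of $G$ either.
   Context: All graphs are finite and simple; a $5$-hole is an induced $5$-cycle. For a graph $G$, let $P(G)$ be the polytope in $\mathbb{R}^{V(G)}$ defined by $0\le x_v\le 1$, $x_u+x_v\le1$ for every edge $uv$, and $\sum_{v\in V(C)}x_v\le(|V(C)|-1)/2$ for every induced odd cycle $C$; $G$ is t-perfect if $P(G)$ equals the convex hull of characteristic vectors of independent sets, t-imperfect otherwise. If $N(v)$ is independent, the t-contraction at $v$ contracts $N(v)\cup\{v\}$ to one vertex. A t-minor is obtained by vertex deletions and t-contractions; proper if it has fewer vertices. $G$ is minimally t-imperfect if it is t-imperfect and all proper t-minors are t-perfect. -}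

module Defs where

open import Data.Bool using (Bool; true; false; not; if_then_else_)
open import Data.Nat as ℕ using (ℕ; zero; suc; _<_)
open import Data.Nat.DivMod using (_mod_)
open import Data.Fin as Fin using (Fin; toℕ)
open import Data.Fin.Properties using (_≟_)
open import Data.Integer using (+_)
open import Data.Rational as ℚ using (ℚ; 0ℚ; 1ℚ; _/_)
open import Data.Product using (Σ; ∃; _×_; _,_)
open import Data.Sum using (_⊎_; inj₁; inj₂)
open import Function.Bundles using (_⇔_)
open import Function.Definitions using (Injective; Surjective)
open import Relation.Binary.PropositionalEquality using (_≡_; _≢_; refl; sym)
open import Relation.Nullary using (¬_; yes; no)
open import Data.Empty using (⊥-elim)

record Graph : Set where
  field
    n      : ℕ
    adj    : Fin n → Fin n → Bool
    adj-sym : ∀ u v → adj u v ≡ adj v u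
    irrefl : ∀ v → adj v v ≡ false
open Graph public

Edge : (G : Graph) → Fin (n G) → Fin (n G) → Set
Edge G u v = adj G u v ≡ true

co-adj : (G : Graph) → Fin (n G) → Fin (n G) → Bool
co-adj G u v with u ≟ v
... | yes _ = false
... | no  _ = not (adj G u v)

co-sym : (G : Graph) → ∀ u v → co-adj G u v ≡ co-adj G v u
co-sym G u v with u ≟ v | v ≟ u
... | yes _ | yes _ = refl
... | yes p | no ¬q = ⊥-elim (¬q (sym p))
... | no ¬p | yes q = ⊥-elim (¬p (sym q))
... | no _  | no _  rewrite Graph.adj-sym G u v = refl

co-irrefl : (G : Graph) → ∀ v → co-adj G v v ≡ false
co-irrefl G v with v ≟ v
... | yes _ = refl
... | no ¬p = ⊥-elim (¬p refl)

complement : Graph → Graph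
complement G = record { n = n G ; adj = co-adj G ; adj-sym = co-sym G ; irrefl = co-irrefl G }

sumFin : (k : ℕ) → (Fin k → ℚ) → ℚ
sumFin zero    f = 0ℚ
sumFin (suc k) f = f Fin.zero ℚ.+ sumFin k (λ i → f (Fin.suc i))

-- Induced odd cycles.  An odd cycle of length 2m+3 (m : ℕ), i.e. any odd
-- length ≥ 3, given by an injective map c from Fin (2m+3) whose induced
-- adjacency is exactly the cyclic one.

oddLen : ℕ → ℕ
oddLen m = suc (suc (suc (m ℕ.+ m)))

csuc : {k : ℕ} → .{{_ : ℕ.NonZero k}} → Fin k → Fin k
csuc {k} i = (suc (toℕ i)) mod k

record InducedOddCycle (G : Graph) : Set where
  field
    m     : ℕ
    c     : Fin (oddLen m) → Fin (n G)
    inj   : Injective _≡_ _≡_ c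
    cyc   : ∀ i j → Edge G (c i) (c j) ⇔ (j ≡ csuc i ⊎ i ≡ csuc j)

InP : (G : Graph) → (Fin (n G) → ℚ) → Set
InP G x =
  (∀ v → 0ℚ ℚ.≤ x v × x v ℚ.≤ 1ℚ) ×
  (∀ u v → Edge G u v → x u ℚ.+ x v ℚ.≤ 1ℚ) ×
  (∀ (C : InducedOddCycle G) →
     sumFin (oddLen (InducedOddCycle.m C)) (λ i → x (InducedOddCycle.c C i))
       ℚ.≤ (+ suc (InducedOddCycle.m C)) / 1)   -- (|C| - 1)/2 = m + 1

Stable : (G : Graph) → (Fin (n G) → Bool) → Set
Stable G S = ∀ u v → Edge G u v → ¬ (S u ≡ true × S v ≡ true)

InStab : (G : Graph) → (Fin (n G) → ℚ) → Set
InStab G x =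
  Σ ℕ λ k → Σ (Fin k → ℚ) λ lam → Σ (Fin k → (Fin (n G) → Bool)) λ S →
    (∀ j → 0ℚ ℚ.≤ lam j) ×
    sumFin k lam ≡ 1ℚ ×
    (∀ j → Stable G (S j)) ×
    (∀ v → x v ≡ sumFin k (λ j → if S j v then lam j else 0ℚ))

TPerfect : Graph → Set
TPerfect G = ∀ (x : Fin (n G) → ℚ) → InP G x ⇔ InStab G x

-- H is (isomorphic to) G - v
IsDeletion : (H G : Graph) → Set
IsDeletion H G = Σ (Fin (n G)) λ v → Σ (Fin (n H) → Fin (n G)) λ f →
  Injective _≡_ _≡_ f ×
  (∀ a → f a ≢ v) ×
  (∀ w → w ≢ v → ∃ λ a → f a ≡ w) ×
  (∀ a b → adj H a b ≡ adj G (f a) (f b))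

ClosedNbhd : (G : Graph) → Fin (n G) → Fin (n G) → Set
ClosedNbhd G v x = x ≡ v ⊎ Edge G v x

-- H is (isomorphic to) the t-contraction of G at v, where N(v) is independent:
-- phi collapses exactly N(v) ∪ {v} to one vertex; H has the induced quotient edges.
IsTContraction : (H G : Graph) → Set
IsTContraction H G = Σ (Fin (n G)) λ v → Σ (Fin (n G) → Fin (n H)) λ phi →
  (∀ x y → Edge G v x → Edge G v y → adj G x y ≡ false) ×
  Surjective _≡_ _≡_ phi ×
  (∀ x y → (phi x ≡ phi y) ⇔ (x ≡ y ⊎ (ClosedNbhd G v x × ClosedNbhd G v y))) ×
  (∀ a b → Edge H a b ⇔
     (a ≢ b × ∃ λ x → ∃ λ y → phi x ≡ a × phi y ≡ b × Edge G x y))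

data TMinor : Graph → Graph → Set where
  tm-refl : ∀ {G} → TMinor G G
  tm-del  : ∀ {H K G} → IsDeletion H K → TMinor K G → TMinor H G
  tm-con  : ∀ {H K G} → IsTContraction H K → TMinor K G → TMinor H G

MinimallyTImperfect : Graph → Set
MinimallyTImperfect G =
  ¬ TPerfect G × (∀ H → TMinor H G → n H < n G → TPerfect H)

_⊕_ : Fin 5 → ℕ → Fin 5
i ⊕ k = (toℕ i ℕ.+ k) mod 5

-- The all-1/3 vector lies in P(K) for every graph K.  If K is t-perfect it is therefore a
-- convex combination of stable sets, and summing it over a list of m vertices of K produces
-- a stable set meeting the list at least m/3 times.  Every G − w is t-perfect when G is
-- minimally t-imperfect, so G − w carries no "light" list: one whose edges leave only
-- independent sets of weight below m/3 (a K₄, or seven vertices of independence number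
-- two); the same holds for the complement of G.  After rotating the indices so that i = 0,
-- a case analysis on the remaining adjacencies among the ten named vertices, checked by
-- evaluation, exhibits such a list in G or in its complement in every case.

module Submission where

open import Agda.Builtin.FromNat using (Number; fromNat)
open import Data.Bool using (Bool; true; false; if_then_else_)
import Data.Bool.Properties as Bool
open import Data.Empty using (⊥-elim)
open import Data.Fin using (Fin; zero; suc; toℕ; punchIn; punchOut)
import Data.Fin.Literals as Fin
open import Data.Fin.Properties
  using (_≟_; _<?_; all?; any?; punchIn-injective; punchInᵢ≢i; punchIn-punchOut)
open import Data.Fin.Subset using (Subset; ∣_∣)
open import Data.Fin.Subset.Properties using (anySubset?)
open import Data.Integer as ℤ using (+_)
import Data.Integer.Properties as ℤ
open import Data.List using (List; filter; cartesianProduct; allFin)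
import Data.List.Relation.Unary.All as All
open All using (All)
open import Data.List.Relation.Unary.All.Properties using (all-filter)
open import Data.Maybe using (Maybe; just; nothing)
import Data.Maybe.Properties as Maybe
open import Data.Nat as ℕ using (ℕ; zero; suc; _*_)
open import Data.Nat.Coprimality as Coprime using (1-coprimeTo)
import Data.Nat.Literals as ℕ
import Data.Nat.Properties as ℕ
open import Data.Nat.Tactic.RingSolver using (solve-∀)
open import Data.Product using (_×_; _,_; ∃)
open import Data.Rational as ℚ using (ℚ; 0ℚ; 1ℚ; _/_; mkℚ; _+_; _≤_; _<_)
open import Data.Rational.Properties as ℚ
  using (+-0-monoid; +-0-commutativeMonoid; ≤-refl; <-irrefl; +-mono-≤; +-monoʳ-≤; +-monoˡ-<;
         +-identityˡ; normalize-coprime; toℚᵘ-injective; toℚᵘ-homo-+; module ≤-Reasoning)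
import Data.Rational.Unnormalised as ℚᵘ
import Data.Rational.Unnormalised.Properties as ℚᵘ
open import Data.Sum using (_⊎_; inj₁; inj₂)
open import Data.Unit using (tt)  -- instance solving the trivial constraint of ℕ literals
open import Data.Vec using (Vec; []; _∷_; tabulate; lookup)
open import Data.Vec.Functional using (Vector)
open import Data.Vec.Properties using (lookup∘tabulate)
open import Function using (_∘_; const)
open import Function.Bundles using (Equivalence; _⇔_)
open import Function.Definitions using (Injective)
open import Relation.Binary.Definitions using (DecidableEquality)
open import Relation.Binary.PropositionalEquality
open import Relation.Nullary using (¬_; Dec; yes; no)
open import Relation.Nullary.Decidable
  using (does; toWitness; map′; ¬?; _×-dec_; _⊎-dec_; _→-dec_)
open import Relation.Unary using (Decidable)

open import Defs

open import Algebra.Properties.CommutativeMonoid.Sum +-0-commutativeMonoid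
  using (sum; sum-syntax; ∑-comm; sum-cong-≗; sum-replicate)
open import Algebra.Properties.Monoid.Mult +-0-monoid
  using (×-assocˡ) renaming (_×_ to _·_)

instance
  ℕ-number : Number ℕ
  ℕ-number = ℕ.number
  Fin-number : ∀ {k} → Number (Fin k)
  Fin-number {k} = Fin.number k

sumFin≡sum : ∀ k (f : Vector ℚ k) → sumFin k f ≡ sum f
sumFin≡sum zero    f = refl
sumFin≡sum (suc k) f = cong (_+_ (f zero)) (sumFin≡sum k (f ∘ suc))

sum-mono-≤ : ∀ {k} {f g : Vector ℚ k} → (∀ i → f i ≤ g i) → sum f ≤ sum g
sum-mono-≤ {zero}  f≤g = ≤-refl
sum-mono-≤ {suc k} f≤g = +-mono-≤ (f≤g zero) (sum-mono-≤ (f≤g ∘ suc))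

·-sum : ∀ n {k} (f : Vector ℚ k) → n · sum f ≡ sum (λ j → n · f j)
·-sum n {k} f = begin
  n · sum f                  ≡⟨ sum-replicate n {sum f} ⟨
  ∑[ i < n ] ∑[ j < k ] f j  ≡⟨ ∑-comm {n} {k} (λ _ → f) ⟩
  ∑[ j < k ] ∑[ i < n ] f j  ≡⟨ sum-cong-≗ (λ j → sum-replicate n {f j}) ⟩
  sum (λ j → n · f j)        ∎
  where open ≡-Reasoning

·-nonneg : ∀ n {q} → 0ℚ ≤ q → 0ℚ ≤ n · q
·-nonneg zero    0≤q = ≤-refl
·-nonneg (suc n) 0≤q = +-mono-≤ 0≤q (·-nonneg n 0≤q)

·-monoˡ-≤ : ∀ {m n q} → m ℕ.≤ n → 0ℚ ≤ q → m · q ≤ n · q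
·-monoˡ-≤ {n = n} ℕ.z≤n       0≤q = ·-nonneg n 0≤q
·-monoˡ-≤ {q = q} (ℕ.s≤s m≤n) 0≤q = +-monoʳ-≤ q (·-monoˡ-≤ m≤n 0≤q)

n·1ℚ≡n/1 : ∀ n → n · 1ℚ ≡ + n / 1
n·1ℚ≡n/1 n = trans (n·1ℚ≡mkℚ n) (sym (normalize-coprime (Coprime.sym (1-coprimeTo n))))
  where
  n·1ℚ≡mkℚ : ∀ n → n · 1ℚ ≡ mkℚ (+ n) 0 (Coprime.sym (1-coprimeTo n))
  n·1ℚ≡mkℚ zero    = refl
  n·1ℚ≡mkℚ (suc n) = trans (cong (_+_ 1ℚ) (n·1ℚ≡mkℚ n)) (toℚᵘ-injective (ℚᵘ.≃-trans
    (toℚᵘ-homo-+ 1ℚ (mkℚ (+ n) 0 (Coprime.sym (1-coprimeTo n))))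
    (ℚᵘ.*≡* (cong (λ z → (+ 1 ℤ.+ z) ℤ.* + 1) (ℤ.*-identityʳ (+ n))))))

sum-indicator : ∀ {m} (b : Fin m → Bool) q → sum (λ a → if b a then q else 0ℚ) ≡ ∣ tabulate b ∣ · q
sum-indicator {zero}  b q = refl
sum-indicator {suc m} b q with b zero
... | true  = cong (_+_ q) (sum-indicator (b ∘ suc) q)
... | false = trans (+-identityˡ _) (sum-indicator (b ∘ suc) q)

sum-decomposition : ∀ {A : Set} {k m} (x : A → ℚ) (λ′ : Fin k → ℚ) (S : Fin k → A → Bool) →
  (∀ v → x v ≡ sumFin k (λ j → if S j v then λ′ j else 0ℚ)) →
  (L : Fin m → A) → sum (x ∘ L) ≡ sum (λ j → ∣ tabulate (S j ∘ L) ∣ · λ′ j)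
sum-decomposition {k = k} {m} x λ′ S x≡ L = begin
  sum (x ∘ L)
    ≡⟨ sum-cong-≗ (λ a → trans (x≡ (L a)) (sumFin≡sum k _)) ⟩
  ∑[ a < m ] ∑[ j < k ] (if S j (L a) then λ′ j else 0ℚ)
    ≡⟨ ∑-comm {m} {k} _ ⟩
  ∑[ j < k ] ∑[ a < m ] (if S j (L a) then λ′ j else 0ℚ)
    ≡⟨ sum-cong-≗ (λ j → sum-indicator (S j ∘ L) (λ′ j)) ⟩
  sum (λ j → ∣ tabulate (S j ∘ L) ∣ · λ′ j) ∎
  where open ≡-Reasoning

third : ℚ
third = + 1 / 3

[3*n]·third≡n·1ℚ : ∀ n → (3 * n) · third ≡ n · 1ℚ
[3*n]·third≡n·1ℚ n = begin
  (3 * n) · third  ≡⟨ cong (_· third) (ℕ.*-comm 3 n) ⟩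
  (n * 3) · third  ≡⟨ ×-assocˡ third n 3 ⟨
  n · (3 · third)  ≡⟨⟩
  n · 1ℚ           ∎
  where open ≡-Reasoning

oddLen≤3*[1+m] : ∀ m → oddLen m ℕ.≤ 3 * suc m
oddLen≤3*[1+m] m = subst (oddLen m ℕ.≤_) (eq m) (ℕ.m≤m+n (oddLen m) m)
  where
  eq : ∀ m → 3 ℕ.+ (m ℕ.+ m) ℕ.+ m ≡ 3 * suc m
  eq = solve-∀

thirds∈P : ∀ K → InP K (const third)
thirds∈P K = (λ _ → 0≤third , third≤1) , (λ _ _ _ → third+third≤1) , oddCycle
  where
  0≤third : 0ℚ ≤ third
  0≤third = toWitness {a? = 0ℚ ℚ.≤? third} _
  third≤1 : third ≤ 1ℚ
  third≤1 = toWitness {a? = third ℚ.≤? 1ℚ} _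
  third+third≤1 : third + third ≤ 1ℚ
  third+third≤1 = toWitness {a? = third + third ℚ.≤? 1ℚ} _
  oddCycle : ∀ (C : InducedOddCycle K) →
    sumFin (oddLen (InducedOddCycle.m C)) (const third) ≤ + suc (InducedOddCycle.m C) / 1
  oddCycle C = begin
    sumFin (oddLen m) (const third) ≡⟨ sumFin≡sum (oddLen m) (const third) ⟩
    sum {oddLen m} (const third)    ≡⟨ sum-replicate (oddLen m) {third} ⟩
    oddLen m · third                ≤⟨ ·-monoˡ-≤ (oddLen≤3*[1+m] m) 0≤third ⟩
    (3 * suc m) · third             ≡⟨ [3*n]·third≡n·1ℚ (suc m) ⟩
    suc m · 1ℚ                      ≡⟨ n·1ℚ≡n/1 (suc m) ⟩
    + suc m / 1                     ∎
    where
    m = InducedOddCycle.m C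
    open ≤-Reasoning

stable-∅ : ∀ K → Stable K (const false)
stable-∅ K _ _ _ ()

small-stable-sets⇒¬TPerfect : ∀ K {m} (L : Fin m → Fin (n K)) →
  (∀ S → Stable K S → 3 * ∣ tabulate (S ∘ L) ∣ ℕ.< m) → ¬ TPerfect K
small-stable-sets⇒¬TPerfect K {zero} L small _ with small (const false) (stable-∅ K)
... | ()
small-stable-sets⇒¬TPerfect K {suc p} L small tp
  with Equivalence.to (tp (const third)) (thirds∈P K)
... | k , λ′ , S , λ′≥0 , Σλ′≡1 , stable , third≡ = <-irrefl refl (begin-strict
  suc p · 1ℚ                       ≡⟨ [3*n]·third≡n·1ℚ (suc p) ⟨
  (3 * suc p) · third              ≡⟨ ×-assocˡ third 3 (suc p) ⟨
  3 · (suc p · third)              ≡⟨ cong (3 ·_) (sum-replicate (suc p) {third}) ⟨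
  3 · sum {suc p} (const third)    ≡⟨ cong (3 ·_) (sum-decomposition (const third) λ′ S third≡ L) ⟩
  3 · sum (λ j → hits j · λ′ j)    ≡⟨ ·-sum 3 (λ j → hits j · λ′ j) ⟩
  sum (λ j → 3 · (hits j · λ′ j))  ≡⟨ sum-cong-≗ (λ j → ×-assocˡ (λ′ j) 3 (hits j)) ⟩
  sum (λ j → (3 * hits j) · λ′ j)  ≤⟨ sum-mono-≤ (λ j → ·-monoˡ-≤ (3*hits≤p j) (λ′≥0 j)) ⟩
  sum (λ j → p · λ′ j)             ≡⟨ ·-sum p λ′ ⟨
  p · sum λ′                       ≡⟨ cong (p ·_) (trans (sym (sumFin≡sum k λ′)) Σλ′≡1) ⟩
  p · 1ℚ                           <⟨ q<1+q (p · 1ℚ) ⟩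
  suc p · 1ℚ                       ∎)
  where
  open ≤-Reasoning
  hits : Fin k → ℕ
  hits j = ∣ tabulate (S j ∘ L) ∣
  3*hits≤p : ∀ j → 3 * hits j ℕ.≤ p
  3*hits≤p j = ℕ.s≤s⁻¹ (small (S j) (stable j))
  q<1+q : ∀ q → q < 1ℚ + q
  q<1+q q = subst (_< 1ℚ + q) (+-identityˡ q) (+-monoˡ-< q (toWitness {a? = 0ℚ ℚ.<? 1ℚ} _))

punchIn′ : ∀ {N} → Fin N → Fin (ℕ.pred N) → Fin N
punchIn′ {suc _} = punchIn

punchIn′-injective : ∀ {N} (w : Fin N) → Injective _≡_ _≡_ (punchIn′ w)
punchIn′-injective {suc _} w = punchIn-injective w _ _

punchIn′-≢ : ∀ {N} (w : Fin N) a → punchIn′ w a ≢ w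
punchIn′-≢ {suc _} = punchInᵢ≢i

punchOut′ : ∀ {N} {w x : Fin N} → w ≢ x → Fin (ℕ.pred N)
punchOut′ {suc _} = punchOut

punchIn′-punchOut′ : ∀ {N} {w x : Fin N} (w≢x : w ≢ x) → punchIn′ w (punchOut′ w≢x) ≡ x
punchIn′-punchOut′ {suc _} = punchIn-punchOut

pred<vertices : ∀ {N} → Fin N → ℕ.pred N ℕ.< N
pred<vertices {suc N} _ = ℕ.n<1+n N

_─_ : (G : Graph) → Fin (n G) → Graph
G ─ w = record
  { n       = ℕ.pred (n G)
  ; adj     = λ a b → adj G (punchIn′ w a) (punchIn′ w b)
  ; adj-sym = λ a b → adj-sym G (punchIn′ w a) (punchIn′ w b)
  ; irrefl  = λ a → irrefl G (punchIn′ w a)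
  }

─-isDeletion : ∀ G w → IsDeletion (G ─ w) G
─-isDeletion G w = w , punchIn′ w , punchIn′-injective w , punchIn′-≢ w
                 , (λ x x≢w → punchOut′ (≢-sym x≢w) , punchIn′-punchOut′ (≢-sym x≢w))
                 , (λ _ _ → refl)

minimallyTImperfect⇒─-TPerfect : ∀ {G} → MinimallyTImperfect G → ∀ w → TPerfect (G ─ w)
minimallyTImperfect⇒─-TPerfect {G} (_ , minimal) w =
  minimal (G ─ w) (tm-del (─-isDeletion G w) tm-refl) (pred<vertices w)

complement-edge : ∀ G {x y} → x ≢ y → adj G x y ≡ false → Edge (complement G) x y
complement-edge G {x} {y} x≢y x≁y with x ≟ y
... | yes x≡y = ⊥-elim (x≢y x≡y)
... | no  _   rewrite x≁y = refl

Pattern : ℕ → Set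
Pattern m = List (Fin m × Fin m)

Realizes : (G : Graph) {m : ℕ} → (Fin m → Fin (n G)) → Pattern m → Set
Realizes G L = All λ (i , j) → Edge G (L i) (L j)

Independent : ∀ {m} → Pattern m → Subset m → Set
Independent P s = All (λ (i , j) → ¬ (lookup s i ≡ true × lookup s j ≡ true)) P

Light : ∀ {m} → Pattern m → Set
Light {m} P = ∀ s → Independent P s → 3 * ∣ s ∣ ℕ.< m

independent? : ∀ {m} (P : Pattern m) s → Dec (Independent P s)
independent? P s = All.all? (λ (i , j) → ¬? ((lookup s i Bool.≟ true) ×-dec (lookup s j Bool.≟ true))) P

light? : ∀ {m} (P : Pattern m) → Dec (Light P)
light? {m} P = map′
  (λ ¬heavy s ind → ℕ.≰⇒> (λ heavy → ¬heavy (s , ind , heavy)))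
  (λ light (s , ind , heavy) → ℕ.<⇒≱ (light s ind) heavy)
  (¬? (anySubset? λ s → independent? P s ×-dec (m ℕ.≤? 3 * ∣ s ∣)))

stable⇒independent : ∀ {G m} {L : Fin m → Fin (n G)} {P S} → Realizes G L P → Stable G S →
  Independent P (tabulate (S ∘ L))
stable⇒independent {L = L} {S = S} realized stable = All.map
  (λ {(i , j)} i~j (Si , Sj) → stable (L i) (L j) i~j
     (trans (sym (lookup∘tabulate (S ∘ L) i)) Si , trans (sym (lookup∘tabulate (S ∘ L) j)) Sj))
  realized

light⇒¬TPerfect : ∀ {G m} {L : Fin m → Fin (n G)} {P} → Realizes G L P → Light P → ¬ TPerfect G
light⇒¬TPerfect {G} {L = L} realized light =
  small-stable-sets⇒¬TPerfect G L λ S stable →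
    light (tabulate (S ∘ L)) (stable⇒independent {G} realized stable)

light⇒¬MinimallyTImperfect : ∀ {G m} {L : Fin m → Fin (n G)} {P} (w : Fin (n G)) →
  (∀ a → w ≢ L a) → Realizes G L P → Light P → ¬ MinimallyTImperfect G
light⇒¬MinimallyTImperfect {G} w avoids realized light minimal =
  light⇒¬TPerfect lifted light (minimallyTImperfect⇒─-TPerfect minimal w)
  where
  lifted : Realizes (G ─ w) (λ a → punchOut′ (avoids a)) _
  lifted = All.map (λ {(i , j)} → subst₂ (Edge G) (sym (punchIn′-punchOut′ (avoids i)))
                                                  (sym (punchIn′-punchOut′ (avoids j)))) realized

data Name : Set where
  V U : Fin 5 → Name

V-injective : ∀ {i j} → V i ≡ V j → i ≡ j
V-injective refl = refl

U-injective : ∀ {i j} → U i ≡ U j → i ≡ j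
U-injective refl = refl

_≟ₙ_ : DecidableEquality Name
V i ≟ₙ V j = map′ (cong V) V-injective (i ≟ j)
U i ≟ₙ U j = map′ (cong U) U-injective (i ≟ j)
V _ ≟ₙ U _ = no λ ()
U _ ≟ₙ V _ = no λ ()

named : ∀ {N} → (Fin 5 → Fin N) → (Fin 5 → Fin N) → Name → Fin N
named v u (V i) = v i
named v u (U i) = u i

named-injective : ∀ {N} {v u : Fin 5 → Fin N} → Injective _≡_ _≡_ v → Injective _≡_ _≡_ u →
  (∀ i j → v i ≢ u j) → Injective _≡_ _≡_ (named v u)
named-injective v-inj u-inj v≢u {V i} {V j} eq = cong V (v-inj eq)
named-injective v-inj u-inj v≢u {U i} {U j} eq = cong U (u-inj eq)
named-injective v-inj u-inj v≢u {V i} {U j} eq = ⊥-elim (v≢u i j eq)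
named-injective v-inj u-inj v≢u {U i} {V j} eq = ⊥-elim (v≢u j i (sym eq))

rotate : Fin 5 → Name → Name
rotate r (V i) = V (r ⊕ toℕ i)
rotate r (U i) = U (r ⊕ toℕ i)

⊕-cancelˡ : ∀ (r i j : Fin 5) → r ⊕ toℕ i ≡ r ⊕ toℕ j → i ≡ j
⊕-cancelˡ = toWitness
  {a? = all? λ r → all? λ i → all? λ j → (r ⊕ toℕ i ≟ r ⊕ toℕ j) →-dec (i ≟ j)} _

⊕-identityʳ : ∀ (r : Fin 5) → r ⊕ 0 ≡ r
⊕-identityʳ = toWitness {a? = all? λ r → r ⊕ 0 ≟ r} _

rotate-injective : ∀ r → Injective _≡_ _≡_ (rotate r)
rotate-injective r {V i} {V j} eq = cong V (⊕-cancelˡ r i j (V-injective eq))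
rotate-injective r {U i} {U j} eq = cong U (⊕-cancelˡ r i j (U-injective eq))
rotate-injective r {V _} {U _} ()
rotate-injective r {U _} {V _} ()

Knowledge : Set
Knowledge = Name → Name → Maybe Bool

Sound : (G : Graph) → (Name → Fin (n G)) → Knowledge → Set
Sound G ⟦_⟧ K = ∀ a b {β} → K a b ≡ just β → adj G ⟦ a ⟧ ⟦ b ⟧ ≡ β

holeEdge? : ∀ i j → Dec (j ≡ i ⊕ 1 ⊎ i ≡ j ⊕ 1)
holeEdge? i j = (j ≟ i ⊕ 1) ⊎-dec (i ≟ j ⊕ 1)

attachment : Fin 5 → Fin 5 → Maybe Bool
attachment i j with j ≟ i ⊕ 2 | j ≟ i ⊕ 3 | j ≟ i ⊕ 1 | j ≟ i ⊕ 4
... | yes _ | _     | _     | _     = just true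
... | no _  | yes _ | _     | _     = just true
... | no _  | no _  | yes _ | _     = just false
... | no _  | no _  | no _  | yes _ = just false
... | no _  | no _  | no _  | no _  = nothing

configuration : Knowledge
configuration (V i) (V j) = just (does (holeEdge? i j))
configuration (U i) (V j) = attachment i j
configuration (V j) (U i) = attachment i j
configuration (U _) (U _) = nothing

⇔-does : ∀ {P : Set} {b} → (b ≡ true ⇔ P) → (P? : Dec P) → b ≡ does P?
⇔-does b⇔P (yes p) = Equivalence.from b⇔P p
⇔-does b⇔P (no ¬p) = Bool.¬-not (¬p ∘ Equivalence.to b⇔P)

configuration-sound : ∀ G (v u : Fin 5 → Fin (n G)) →
  (∀ i j → Edge G (v i) (v j) ⇔ (j ≡ i ⊕ 1 ⊎ i ≡ j ⊕ 1)) →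
  (∀ i → Edge G (u i) (v (i ⊕ 2)) × Edge G (u i) (v (i ⊕ 3))
       × adj G (u i) (v (i ⊕ 1)) ≡ false × adj G (u i) (v (i ⊕ 4)) ≡ false) →
  Sound G (named v u) configuration
configuration-sound G v u hole attached = sound
  where
  attachment-sound : ∀ i j {β} → attachment i j ≡ just β → adj G (u i) (v j) ≡ β
  attachment-sound i j with j ≟ i ⊕ 2 | j ≟ i ⊕ 3 | j ≟ i ⊕ 1 | j ≟ i ⊕ 4 | attached i
  ... | yes refl | _        | _        | _        | u~v₂ , _ , _ , _ = λ { refl → u~v₂ }
  ... | no _     | yes refl | _        | _        | _ , u~v₃ , _ , _ = λ { refl → u~v₃ }
  ... | no _     | no _     | yes refl | _        | _ , _ , u≁v₁ , _ = λ { refl → u≁v₁ }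
  ... | no _     | no _     | no _     | yes refl | _ , _ , _ , u≁v₄ = λ { refl → u≁v₄ }
  ... | no _     | no _     | no _     | no _     | _                = λ ()
  sound : Sound G (named v u) configuration
  sound (V i) (V j) refl = ⇔-does (hole i j) (holeEdge? i j)
  sound (U i) (V j) eq   = attachment-sound i j eq
  sound (V j) (U i) eq   = trans (adj-sym G (v j) (u i)) (attachment-sound i j eq)
  sound (U _) (U _) ()

configuration-rotation : ∀ r a b → configuration (rotate r a) (rotate r b) ≡ configuration a b
configuration-rotation r (V i) (V j) = cong just (hole r i j)
  where
  hole : ∀ (r i j : Fin 5) → does (holeEdge? (r ⊕ toℕ i) (r ⊕ toℕ j)) ≡ does (holeEdge? i j)
  hole = toWitness {a? = all? λ r → all? λ i → all? λ j → _ Bool.≟ _} _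
configuration-rotation r (U i) (V j) = attachment-rotation r i j
  where
  attachment-rotation : ∀ (r i j : Fin 5) → attachment (r ⊕ toℕ i) (r ⊕ toℕ j) ≡ attachment i j
  attachment-rotation = toWitness {a? = all? λ r → all? λ i → all? λ j → Maybe.≡-dec Bool._≟_ _ _} _
configuration-rotation r (V j) (U i) = configuration-rotation r (U i) (V j)
configuration-rotation r (U _) (U _) = refl

rotation-sound : ∀ {G ⟦_⟧} r → Sound G ⟦_⟧ configuration → Sound G (⟦_⟧ ∘ rotate r) configuration
rotation-sound r sound a b eq = sound (rotate r a) (rotate r b) (trans (configuration-rotation r a b) eq)

learn : Name → Name → Bool → Knowledge → Knowledge
learn a b β K x y with (x ≟ₙ a) ×-dec (y ≟ₙ b) | (x ≟ₙ b) ×-dec (y ≟ₙ a)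
... | yes _ | _     = just β
... | no _  | yes _ = just β
... | no _  | no _  = K x y

learn-sound : ∀ {G ⟦_⟧ K a b β} → Sound G ⟦_⟧ K → adj G ⟦ a ⟧ ⟦ b ⟧ ≡ β →
  Sound G ⟦_⟧ (learn a b β K)
learn-sound {G} {⟦_⟧} {a = a} {b} sound a~b x y
  with (x ≟ₙ a) ×-dec (y ≟ₙ b) | (x ≟ₙ b) ×-dec (y ≟ₙ a)
... | yes (refl , refl) | _                 = λ { refl → a~b }
... | no _              | yes (refl , refl) = λ { refl → trans (adj-sym G ⟦ b ⟧ ⟦ a ⟧) a~b }
... | no _              | no _              = sound x y

KnownEdge : Bool → Knowledge → Name → Name → Set
KnownEdge β K a b = K a b ≡ just β × a ≢ b

KnownEdgeAt : ∀ {m} → Bool → Knowledge → Vec Name m → Fin m × Fin m → Set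
KnownEdgeAt β K L (i , j) = toℕ i ℕ.< toℕ j × KnownEdge β K (lookup L i) (lookup L j)

knownEdgeAt? : ∀ {m} β K (L : Vec Name m) → Decidable (KnownEdgeAt β K L)
knownEdgeAt? β K L (i , j) = (i <? j) ×-dec
  (Maybe.≡-dec Bool._≟_ (K (lookup L i) (lookup L j)) (just β) ×-dec ¬? (lookup L i ≟ₙ lookup L j))

allPairs : ∀ m → List (Fin m × Fin m)
allPairs m = cartesianProduct (allFin m) (allFin m)

knownEdges : ∀ {m} → Bool → Knowledge → Vec Name m → Pattern m
knownEdges {m} β K L = filter (knownEdgeAt? β K L) (allPairs m)

knownEdges-realized : ∀ {G ⟦_⟧ K m} (L : Vec Name m) → Sound G ⟦_⟧ K →
  Realizes G (⟦_⟧ ∘ lookup L) (knownEdges true K L)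
knownEdges-realized {K = K} {m} L sound = All.map
  (λ { {i , j} (_ , known , _) → sound (lookup L i) (lookup L j) known })
  (all-filter (knownEdgeAt? true K L) (allPairs m))

knownNonEdges-realized : ∀ {G ⟦_⟧ K m} (L : Vec Name m) → Injective _≡_ _≡_ ⟦_⟧ → Sound G ⟦_⟧ K →
  Realizes (complement G) (⟦_⟧ ∘ lookup L) (knownEdges false K L)
knownNonEdges-realized {G} {K = K} {m} L injective sound = All.map
  (λ { {i , j} (_ , known , a≢b) →
          complement-edge G (a≢b ∘ injective) (sound (lookup L i) (lookup L j) known) })
  (all-filter (knownEdgeAt? false K L) (allPairs m))

Refutation : ∀ {m} → Knowledge → Vec Name m → Set
Refutation K L = (∃ λ j → ∀ a → V j ≢ lookup L a)
               × (Light (knownEdges true K L) ⊎ Light (knownEdges false K L))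

refutation? : ∀ {m} K (L : Vec Name m) → Dec (Refutation K L)
refutation? K L = any? (λ j → all? λ a → ¬? (V j ≟ₙ lookup L a))
           ×-dec (light? (knownEdges true K L) ⊎-dec light? (knownEdges false K L))

-- A leaf lists vertices with multiplicity: a repeated vertex counts twice in the weight.
data CaseTree : Set where
  leaf   : ∀ {m} → Vec Name m → CaseTree
  branch : Name → Name → CaseTree → CaseTree → CaseTree

Refuted : Knowledge → CaseTree → Set
Refuted K (leaf L)                   = Refutation K L
Refuted K (branch a b ifEdge ifNone) = Refuted (learn a b true K) ifEdge × Refuted (learn a b false K) ifNone

refuted? : ∀ K t → Dec (Refuted K t)
refuted? K (leaf L)                   = refutation? K L
refuted? K (branch a b ifEdge ifNone) =
  refuted? (learn a b true K) ifEdge ×-dec refuted? (learn a b false K) ifNone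

module _ {G : Graph} {⟦_⟧ : Name → Fin (n G)} (injective : Injective _≡_ _≡_ ⟦_⟧)
         (minimal : MinimallyTImperfect G) (minimalᶜ : MinimallyTImperfect (complement G)) where

  refutation-sound : ∀ {K m} (L : Vec Name m) → Sound G ⟦_⟧ K → ¬ Refutation K L
  refutation-sound L sound ((j , avoids) , inj₁ light) =
    light⇒¬MinimallyTImperfect ⟦ V j ⟧ (λ a → avoids a ∘ injective)
      (knownEdges-realized {G} {⟦_⟧} L sound) light minimal
  refutation-sound L sound ((j , avoids) , inj₂ light) =
    light⇒¬MinimallyTImperfect ⟦ V j ⟧ (λ a → avoids a ∘ injective)
      (knownNonEdges-realized {G} {⟦_⟧} L injective sound) light minimalᶜ

  refuted-sound : ∀ {K} t → Sound G ⟦_⟧ K → ¬ Refuted K t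
  refuted-sound (leaf L) sound = refutation-sound L sound
  refuted-sound (branch a b ifEdge ifNone) sound (refutedEdge , refutedNone)
    with adj G ⟦ a ⟧ ⟦ b ⟧ in a~b
  ... | true  = refuted-sound ifEdge (learn-sound {G} {⟦_⟧} sound a~b) refutedEdge
  ... | false = refuted-sound ifNone (learn-sound {G} {⟦_⟧} sound a~b) refutedNone

start : Knowledge
start = learn (U 4) (U 1) true (learn (U 0) (U 1) false (learn (U 0) (U 4) false configuration))

caseTree : CaseTree
caseTree =
  branch (U 1) (U 2)
    (branch (U 3) (U 4)
      (leaf (V 0 ∷ V 1 ∷ V 4 ∷ U 1 ∷ U 2 ∷ U 3 ∷ U 4 ∷ []))
      (branch (V 4) (U 4)
        (branch (U 2) (U 3)
          (leaf (V 0 ∷ V 1 ∷ V 4 ∷ U 1 ∷ U 2 ∷ U 3 ∷ U 4 ∷ []))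
          (branch (U 2) (U 4)
            (leaf (V 4 ∷ U 1 ∷ U 2 ∷ U 4 ∷ []))
            (branch (V 3) (U 3)
              (branch (V 0) (U 0)
                (branch (U 0) (U 3)
                  (leaf (V 0 ∷ V 3 ∷ V 4 ∷ U 0 ∷ U 1 ∷ U 2 ∷ U 3 ∷ []))
                  (leaf (V 1 ∷ V 3 ∷ V 4 ∷ U 0 ∷ U 2 ∷ U 3 ∷ U 4 ∷ [])))
                (branch (V 1) (U 1)
                  (branch (U 1) (U 3)
                    (leaf (U 1 ∷ U 1 ∷ V 1 ∷ U 3 ∷ V 3 ∷ V 4 ∷ U 4 ∷ []))
                    (leaf (V 0 ∷ V 2 ∷ V 3 ∷ U 1 ∷ U 2 ∷ U 3 ∷ U 4 ∷ [])))
                  (leaf (V 0 ∷ V 1 ∷ V 3 ∷ U 0 ∷ U 1 ∷ U 2 ∷ U 4 ∷ []))))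
              (leaf (V 3 ∷ U 2 ∷ U 3 ∷ U 4 ∷ [])))))
        (branch (V 0) (U 0)
          (branch (U 0) (U 3)
            (branch (V 3) (U 3)
              (leaf (V 0 ∷ V 3 ∷ V 4 ∷ U 0 ∷ U 1 ∷ U 2 ∷ U 3 ∷ []))
              (branch (U 2) (U 3)
                (leaf (V 0 ∷ V 3 ∷ V 4 ∷ U 0 ∷ U 1 ∷ U 2 ∷ U 3 ∷ []))
                (leaf (V 1 ∷ V 3 ∷ V 4 ∷ U 0 ∷ U 2 ∷ U 3 ∷ U 4 ∷ []))))
            (leaf (V 4 ∷ U 0 ∷ U 3 ∷ U 4 ∷ [])))
          (leaf (V 0 ∷ V 2 ∷ V 4 ∷ U 0 ∷ U 1 ∷ U 3 ∷ U 4 ∷ [])))))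
    (branch (V 1) (U 1)
      (branch (V 4) (U 4)
        (branch (U 2) (U 3)
          (leaf (V 0 ∷ V 1 ∷ V 4 ∷ U 1 ∷ U 2 ∷ U 3 ∷ U 4 ∷ []))
          (branch (U 1) (U 3)
            (branch (V 3) (U 3)
              (leaf (U 1 ∷ U 1 ∷ V 1 ∷ U 3 ∷ V 3 ∷ V 4 ∷ U 4 ∷ []))
              (branch (U 2) (U 4)
                (leaf (V 0 ∷ V 1 ∷ V 4 ∷ U 1 ∷ U 2 ∷ U 3 ∷ U 4 ∷ []))
                (branch (U 3) (U 4)
                  (leaf (V 1 ∷ U 1 ∷ U 3 ∷ U 4 ∷ []))
                  (leaf (V 3 ∷ U 2 ∷ U 3 ∷ U 4 ∷ [])))))
            (branch (V 2) (U 2)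
              (branch (U 2) (U 4)
                (leaf (U 4 ∷ U 4 ∷ V 1 ∷ V 2 ∷ U 2 ∷ V 4 ∷ U 1 ∷ []))
                (leaf (V 0 ∷ V 2 ∷ V 3 ∷ U 1 ∷ U 2 ∷ U 3 ∷ U 4 ∷ [])))
              (leaf (V 2 ∷ U 1 ∷ U 2 ∷ U 3 ∷ [])))))
        (branch (U 1) (U 3)
          (branch (U 3) (U 4)
            (leaf (V 1 ∷ U 1 ∷ U 3 ∷ U 4 ∷ []))
            (branch (V 0) (U 0)
              (branch (U 0) (U 3)
                (branch (V 3) (U 3)
                  (leaf (V 1 ∷ V 2 ∷ V 3 ∷ U 0 ∷ U 1 ∷ U 3 ∷ U 4 ∷ []))
                  (branch (U 0) (U 2)
                    (branch (U 2) (U 3)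
                      (leaf (V 0 ∷ U 0 ∷ U 2 ∷ U 3 ∷ []))
                      (leaf (V 1 ∷ V 3 ∷ V 4 ∷ U 0 ∷ U 2 ∷ U 3 ∷ U 4 ∷ [])))
                    (leaf (V 1 ∷ V 3 ∷ V 4 ∷ U 0 ∷ U 2 ∷ U 3 ∷ U 4 ∷ []))))
                (leaf (V 4 ∷ U 0 ∷ U 3 ∷ U 4 ∷ [])))
              (leaf (V 0 ∷ V 2 ∷ V 4 ∷ U 0 ∷ U 1 ∷ U 3 ∷ U 4 ∷ []))))
          (branch (V 0) (U 0)
            (branch (U 0) (U 2)
              (branch (U 0) (U 3)
                (branch (U 2) (U 3)
                  (leaf (V 0 ∷ U 0 ∷ U 2 ∷ U 3 ∷ []))
                  (branch (V 2) (U 2)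
                    (branch (U 2) (U 4)
                      (leaf (V 0 ∷ V 1 ∷ V 2 ∷ U 0 ∷ U 2 ∷ U 3 ∷ U 4 ∷ []))
                      (leaf (V 0 ∷ V 2 ∷ V 3 ∷ U 1 ∷ U 2 ∷ U 3 ∷ U 4 ∷ [])))
                    (leaf (V 2 ∷ U 1 ∷ U 2 ∷ U 3 ∷ []))))
                (leaf (V 0 ∷ V 2 ∷ V 4 ∷ U 0 ∷ U 1 ∷ U 3 ∷ U 4 ∷ [])))
              (leaf (V 1 ∷ V 2 ∷ V 4 ∷ U 0 ∷ U 1 ∷ U 2 ∷ U 3 ∷ [])))
            (leaf (V 0 ∷ V 2 ∷ V 4 ∷ U 0 ∷ U 1 ∷ U 3 ∷ U 4 ∷ [])))))
      (branch (V 0) (U 0)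
        (branch (U 0) (U 2)
          (branch (V 2) (U 2)
            (branch (U 3) (U 4)
              (leaf (V 0 ∷ V 1 ∷ V 2 ∷ U 0 ∷ U 2 ∷ U 3 ∷ U 4 ∷ []))
              (branch (U 0) (U 3)
                (branch (V 3) (U 3)
                  (leaf (U 0 ∷ U 0 ∷ V 0 ∷ U 2 ∷ V 2 ∷ V 3 ∷ U 3 ∷ []))
                  (branch (U 2) (U 3)
                    (leaf (V 0 ∷ U 0 ∷ U 2 ∷ U 3 ∷ []))
                    (leaf (V 1 ∷ V 3 ∷ U 0 ∷ U 1 ∷ U 2 ∷ U 3 ∷ U 4 ∷ []))))
                (branch (V 4) (U 4)
                  (branch (U 2) (U 4)
                    (leaf (V 2 ∷ V 3 ∷ V 4 ∷ U 0 ∷ U 1 ∷ U 2 ∷ U 4 ∷ []))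
                    (leaf (V 1 ∷ V 3 ∷ V 4 ∷ U 0 ∷ U 2 ∷ U 3 ∷ U 4 ∷ [])))
                  (leaf (V 4 ∷ U 0 ∷ U 3 ∷ U 4 ∷ [])))))
            (branch (U 0) (U 3)
              (branch (U 2) (U 3)
                (leaf (V 0 ∷ U 0 ∷ U 2 ∷ U 3 ∷ []))
                (leaf (V 1 ∷ V 2 ∷ V 4 ∷ U 0 ∷ U 1 ∷ U 2 ∷ U 3 ∷ [])))
              (leaf (V 1 ∷ V 2 ∷ V 4 ∷ U 0 ∷ U 1 ∷ U 2 ∷ U 3 ∷ []))))
          (leaf (V 1 ∷ U 0 ∷ U 1 ∷ U 2 ∷ [])))
        (leaf (V 0 ∷ V 1 ∷ V 3 ∷ U 0 ∷ U 1 ∷ U 2 ∷ U 4 ∷ []))))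

caseTree-refuted : Refuted start caseTree
caseTree-refuted = toWitness {a? = refuted? start caseTree} _

proposition18 :
    (G : Graph) → (n10 : n G ≡ 10) →
    MinimallyTImperfect G → MinimallyTImperfect (complement G) →
    (v u : Fin 5 → Fin (n G)) →
    Injective _≡_ _≡_ v → Injective _≡_ _≡_ u → (∀ i j → v i ≢ u j) →
    (∀ i j → Edge G (v i) (v j) ⇔ (j ≡ i ⊕ 1 ⊎ i ≡ j ⊕ 1)) →
    (∀ i → Edge G (u i) (v (i ⊕ 2)) × Edge G (u i) (v (i ⊕ 3))
         × adj G (u i) (v (i ⊕ 1)) ≡ false × adj G (u i) (v (i ⊕ 4)) ≡ false) →
    (i : Fin 5) →
    ¬ Edge G (u i) (u (i ⊕ 4)) → ¬ Edge G (u i) (u (i ⊕ 1)) →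
    ¬ Edge G (u (i ⊕ 4)) (u (i ⊕ 1))
proposition18 G _ minimal minimalᶜ v u v-inj u-inj v≢u hole attached i u₀≁u₄ u₀≁u₁ u₄~u₁ =
  refuted-sound injective minimal minimalᶜ caseTree start-sound caseTree-refuted
  where
  ⟦_⟧ : Name → Fin (n G)
  ⟦ a ⟧ = named v u (rotate i a)
  injective : Injective _≡_ _≡_ ⟦_⟧
  injective = rotate-injective i ∘ named-injective v-inj u-inj v≢u
  u₀≡uᵢ : u (i ⊕ 0) ≡ u i
  u₀≡uᵢ = cong u (⊕-identityʳ i)
  start-sound : Sound G ⟦_⟧ start
  start-sound =
    learn-sound {G} {⟦_⟧} (learn-sound {G} {⟦_⟧} (learn-sound {G} {⟦_⟧}
      (rotation-sound {G} {named v u} i (configuration-sound G v u hole attached))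
      (subst (λ x → adj G x (u (i ⊕ 4)) ≡ false) (sym u₀≡uᵢ) (Bool.¬-not u₀≁u₄)))
      (subst (λ x → adj G x (u (i ⊕ 1)) ≡ false) (sym u₀≡uᵢ) (Bool.¬-not u₀≁u₁)))
      u₄~u₁
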